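{- Let $N\geq 5$ and $m=\lfloor N/2\rfloor$. Let $L$ be the Laplacian matrix of $C_N^2$ (rows and columns indexed by $\mathbb{Z}_N=\{0,1,\dots,N-1\}$), and let $L'$ be obtained from $L$ by deleting the row and column of vertex $0$, indexed by $1,\dots,N-1$. Define the $m\times m$ matrix $H_N$ as follows. If $N$ is odd, $H_N(i,j)=L'(i,j)+L'(i,N-j)$ for $1\le i,j\le m$. If $N$ is even, first set $H_N(i,j)=L'(i,j)+L'(i,N-j)$ for $j\neq m$ and $H_N(i,m)=L'(i,m)$, and then multiply the last row (row $m$) by $\tfrac12$. Let $U_N$ be the $m\times m$ upper triangular matrix with $U_N(i,j)=1$ for $j\ge i$ and $0$ otherwise; let $W_N$ be the $m\times m$ lower bidiagonal matrix with $1$ on the diagonal, $W_N(i+1,i)=F_{2i-1}/F_{2i+1}$ for $1\le i\le m-1$, and all other entries $0$; and let $D_N$ be the $m\times m$ diagonal matrix with $D_N(i,i)=F_{2i+1}/F_{2i-1}$ for $1\le i\le m-1$ and $D_N(m,m)=F_N/F_{2m-1}$. Then \[ H_N=U_N^{ -1}\,W_N\,D_N\,{}^tW_N\,{}^tU_N^{ -1}. \]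
   Context: $C_N^2$ is the graph with vertex set $\mathbb{Z}_N$ where $u,v$ are adjacent iff $u-v\in\{\pm1,\pm2\}$ mod $N$; its Laplacian is $L=4I-A$ with $A$ the adjacency matrix. $F_i$ is the $i$-th Fibonacci number ($F_0=0,F_1=1$). ${}^tM$ denotes the transpose of $M$. -}

module Defs where

open import Data.Nat as ℕ using (ℕ; zero; suc; _+_; _*_; _∸_; _≤_; NonZero; _≡ᵇ_)
open import Data.Nat.Properties as ℕP using (≤-trans; m≤m+n)
open import Data.Nat.DivMod using (_%_; _/_)
open import Data.Integer as ℤ using (ℤ; +_)
open import Data.Integer.DivMod using (_%ℕ_)
open import Data.Fin using (Fin; toℕ)
import Data.Fin as F
open import Data.Bool using (Bool; true; false; if_then_else_; _∨_; _∧_)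
open import Data.Rational as ℚ using (ℚ; 0ℚ; 1ℚ; ½)
open import Relation.Binary.PropositionalEquality using (_≡_)
open import Data.Product using (_×_)

fib : ℕ → ℕ
fib zero = 0
fib (suc zero) = 1
fib (suc (suc n)) = fib (suc n) + fib n

fib-suc-pos : ∀ n → 1 ≤ fib (suc n)
fib-suc-pos zero = ℕ.s≤s ℕ.z≤n
fib-suc-pos (suc n) = ≤-trans (fib-suc-pos n) (m≤m+n (fib (suc n)) (fib n))

fib-suc-nonZero : ∀ n → NonZero (fib (suc n))
fib-suc-nonZero n = ℕ.>-nonZero (fib-suc-pos n)

fibRatio : ℕ → ℕ → ℚ
fibRatio a b = ℚ._/_ (+ fib a) (fib (suc b)) {{fib-suc-nonZero b}}

nℚ : ℕ → ℚ
nℚ n = ℚ._/_ (+ n) 1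

Mat : ℕ → Set
Mat n = Fin n → Fin n → ℚ

sumF : ∀ {n} → (Fin n → ℚ) → ℚ
sumF {zero} f = 0ℚ
sumF {suc n} f = f F.zero ℚ.+ sumF (λ i → f (F.suc i))

_⊗_ : ∀ {n} → Mat n → Mat n → Mat n
(A ⊗ B) i j = sumF (λ k → A i k ℚ.* B k j)

infixl 7 _⊗_

transpose : ∀ {n} → Mat n → Mat n
transpose A i j = A j i

idMat : ∀ {n} → Mat n
idMat i j = if toℕ i ≡ᵇ toℕ j then 1ℚ else 0ℚ

IsInverse : ∀ {n} → Mat n → Mat n → Set
IsInverse A B = (∀ i j → (A ⊗ B) i j ≡ idMat i j) × (∀ i j → (B ⊗ A) i j ≡ idMat i j)

-- The graph C_N^2 on vertex set ℤ_N; vertices given as naturals, read mod N.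

diffMod : (N : ℕ) → .{{NonZero N}} → ℕ → ℕ → ℕ
diffMod N u v = ((+ u) ℤ.- (+ v)) %ℕ N

adjB : (N : ℕ) → .{{NonZero N}} → ℕ → ℕ → Bool
adjB N u v = let d = diffMod N u v in
  (d ≡ᵇ 1) ∨ (d ≡ᵇ 2) ∨ (d ≡ᵇ (N ∸ 1)) ∨ (d ≡ᵇ (N ∸ 2))

adjC : (N : ℕ) → .{{NonZero N}} → ℕ → ℕ → ℚ
adjC N u v = if adjB N u v then 1ℚ else 0ℚ

lapC : (N : ℕ) → .{{NonZero N}} → ℕ → ℕ → ℚ
lapC N u v = (if diffMod N u v ≡ᵇ 0 then nℚ 4 else 0ℚ) ℚ.- adjC N u v

-- The matrices of Theorem 3.1; index i : Fin (N / 2) stands for i+1 ∈ {1,…,m}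

-- L' : L with row/column of vertex 0 deleted, indexed by 1,…,N-1
-- (L'(i,j) = L(i,j) for 1 ≤ i,j ≤ N-1)
lap' : (N : ℕ) → .{{NonZero N}} → ℕ → ℕ → ℚ
lap' N i j = lapC N i j

H : (N : ℕ) → .{{NonZero N}} → Mat (N / 2)
H N i j =
  let m = N / 2
      I = suc (toℕ i)
      J = suc (toℕ j)
      odd = N % 2 ≡ᵇ 1
      entry = if odd then lap' N I J ℚ.+ lap' N I (N ∸ J)
              else (if J ≡ᵇ m then lap' N I m else lap' N I J ℚ.+ lap' N I (N ∸ J))
  in if odd then entry else (if I ≡ᵇ m then ½ ℚ.* entry else entry)

U : (N : ℕ) → Mat (N / 2)
U N i j = if toℕ i ℕ.≤ᵇ toℕ j then 1ℚ else 0ℚ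

-- W(I+1, I) = F_{2I-1}/F_{2I+1}; with I = toℕ j + 1: F_{2 j' + 1} / F_{2 j' + 3}
W : (N : ℕ) → Mat (N / 2)
W N i j =
  if toℕ i ≡ᵇ toℕ j then 1ℚ
  else if toℕ i ≡ᵇ suc (toℕ j) then fibRatio (1 + 2 * toℕ j) (2 + 2 * toℕ j)
  else 0ℚ

-- D(I,I) = F_{2I+1}/F_{2I-1} for I ≤ m-1, D(m,m) = F_N / F_{2m-1}
D : (N : ℕ) → Mat (N / 2)
D N i j =
  if toℕ i ≡ᵇ toℕ j then
    (if suc (toℕ i) ≡ᵇ N / 2 then fibRatio N (2 * toℕ i)
     else fibRatio (3 + 2 * toℕ i) (2 * toℕ i))
  else 0ℚ

-- Let V = U⁻¹: it has 1 on the diagonal and −1 just above it, so conjugating by V turns a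
-- matrix X into its second difference X(a,b) − X(a+1,b) − X(a,b+1) + X(a+1,b+1), where
-- terms with an index past m are dropped.  W D ᵗW is tridiagonal: its off-diagonal entries
-- are W(a+1,a)·D(a,a) = 1, its diagonal is 2, 3, …, 3 and finally
-- (F_{2m−3} + F_N)/F_{2m−1}, which F_t + F_{t+4} = 3 F_{t+2} and F_t + F_{t+3} = 2 F_{t+2}
-- turn into 3 for odd N and 2 for even N.  On the other side H_N(i,j) is read off the
-- circulant Laplacian as ℓ(i − j) + ℓ(i + j), ℓ being its first column, except on the last
-- row and column when N is even.  Both sides are then compared entrywise, according to the
-- offset i − j ∈ {0, ±1, ±2, beyond} and to whether i or j is (next to) the last index m.
module Submission where

open import Defs
open import Data.Nat using (ℕ; _≤_; NonZero; _/_)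
open import Data.Fin using (Fin)
open import Data.Product using (Σ; _×_)
open import Relation.Binary.PropositionalEquality using (_≡_)

open import Algebra.Bundles using (CommutativeRing)
open import Data.Bool using (Bool; true; false; if_then_else_; _∨_)
open import Data.Empty using (⊥-elim)
open import Data.Fin as Fin using (toℕ)
import Data.Fin.Properties as Fin
open import Data.Integer as ℤ using (-[1+_]; _%ℕ_)
import Data.Integer.Properties as ℤ
open import Data.Nat as ℕ using (zero; suc; _+_; _*_; _∸_; _<_; _%_; _≡ᵇ_; _≤ᵇ_; z<s; s<s; s≤s; z≤n)
import Data.Nat.Properties as ℕ
open import Data.Nat.DivMod using (m≡m%n+[m/n]*n; m%n<n; m<n⇒m%n≡m)
open import Data.Nat.Tactic.RingSolver using (solve-∀)
open import Data.Product using (_,_)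
open import Data.Rational as ℚ using (ℚ; 0ℚ; 1ℚ; ½; toℚᵘ)
import Data.Rational.Properties as ℚ
import Data.Rational.Unnormalised as ℚᵘ
import Data.Rational.Unnormalised.Properties as ℚᵘ
open import Data.Sum using (inj₁; inj₂; [_,_]′)
open import Data.Vec.Functional using (Vector)
open import Function using (_∘_; flip)
open import Relation.Binary.Definitions using (tri<; tri≈; tri>)
open import Relation.Binary.PropositionalEquality
open import Relation.Nullary.Decidable using (dec-true; dec-false)

open import Algebra.Properties.Ring ℚ.+-*-ring using (-1*x≈-x)
open import Algebra.Properties.Semiring.Sum (CommutativeRing.semiring ℚ.+-*-commutativeRing)
  using (sum; sum-cong-≗; sum-replicate-zero; ∑-comm; *-distribˡ-sum; *-distribʳ-sum)

-- Fractions of naturals and Fibonacci ratios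

private
  toℚᵘ-/ : ∀ a b .{{_ : NonZero b}} → toℚᵘ (ℤ.+ a ℚ./ b) ℚᵘ.≃ (ℤ.+ a ℚᵘ./ b)
  toℚᵘ-/ a (suc b) = ℚ.toℚᵘ-fromℚᵘ (ℚᵘ.mkℚᵘ (ℤ.+ a) b)

/-cross : ∀ a b c d .{{_ : NonZero b}} .{{_ : NonZero d}} →
          a * d ≡ c * b → ℤ.+ a ℚ./ b ≡ ℤ.+ c ℚ./ d
/-cross a (suc b) c (suc d) ad≡cb =
  ℚ.fromℚᵘ-cong {ℤ.+ a ℚᵘ./ suc b} {ℤ.+ c ℚᵘ./ suc d} (ℚᵘ.*≡* (begin
    ℤ.+ a ℤ.* ℤ.+ suc d   ≡⟨ ℤ.pos-* a (suc d) ⟨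
    ℤ.+ (a * suc d)       ≡⟨ cong ℤ.+_ ad≡cb ⟩
    ℤ.+ (c * suc b)       ≡⟨ ℤ.pos-* c (suc b) ⟩
    ℤ.+ c ℤ.* ℤ.+ suc b   ∎))
  where open ≡-Reasoning

/-* : ∀ a b c d .{{_ : NonZero b}} .{{_ : NonZero d}} →
      (ℤ.+ a ℚ./ b) ℚ.* (ℤ.+ c ℚ./ d) ≡ (ℤ.+ (a * c) ℚ./ (b * d)) {{ℕ.m*n≢0 b d}}
/-* a b@(suc _) c d@(suc _) = ℚ.toℚᵘ-injective (begin
  toℚᵘ ((ℤ.+ a ℚ./ b) ℚ.* (ℤ.+ c ℚ./ d))        ≈⟨ ℚ.toℚᵘ-homo-* (ℤ.+ a ℚ./ b) (ℤ.+ c ℚ./ d) ⟩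
  toℚᵘ (ℤ.+ a ℚ./ b) ℚᵘ.* toℚᵘ (ℤ.+ c ℚ./ d)    ≈⟨ ℚᵘ.*-cong (toℚᵘ-/ a b) (toℚᵘ-/ c d) ⟩
  (ℤ.+ a ℚᵘ./ b) ℚᵘ.* (ℤ.+ c ℚᵘ./ d)            ≈⟨ ℚᵘ.≃-reflexive (cong (ℚᵘ._/ (b * d)) (ℤ.pos-* a c)) ⟨
  ℤ.+ (a * c) ℚᵘ./ (b * d)                     ≈⟨ toℚᵘ-/ (a * c) (b * d) ⟨
  toℚᵘ (ℤ.+ (a * c) ℚ./ (b * d))                ∎)
  where open ℚᵘ.≃-Reasoning

/-+ : ∀ a b c d .{{_ : NonZero b}} .{{_ : NonZero d}} →
      (ℤ.+ a ℚ./ b) ℚ.+ (ℤ.+ c ℚ./ d) ≡ (ℤ.+ (a * d + c * b) ℚ./ (b * d)) {{ℕ.m*n≢0 b d}}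
/-+ a b@(suc _) c d@(suc _) = ℚ.toℚᵘ-injective (begin
  toℚᵘ ((ℤ.+ a ℚ./ b) ℚ.+ (ℤ.+ c ℚ./ d))        ≈⟨ ℚ.toℚᵘ-homo-+ (ℤ.+ a ℚ./ b) (ℤ.+ c ℚ./ d) ⟩
  toℚᵘ (ℤ.+ a ℚ./ b) ℚᵘ.+ toℚᵘ (ℤ.+ c ℚ./ d)    ≈⟨ ℚᵘ.+-cong (toℚᵘ-/ a b) (toℚᵘ-/ c d) ⟩
  (ℤ.+ a ℚᵘ./ b) ℚᵘ.+ (ℤ.+ c ℚᵘ./ d)            ≈⟨ ℚᵘ.≃-reflexive (cong (ℚᵘ._/ (b * d)) numerator) ⟨
  ℤ.+ (a * d + c * b) ℚᵘ./ (b * d)             ≈⟨ toℚᵘ-/ (a * d + c * b) (b * d) ⟨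
  toℚᵘ (ℤ.+ (a * d + c * b) ℚ./ (b * d))        ∎)
  where
  open ℚᵘ.≃-Reasoning
  numerator : ℤ.+ (a * d + c * b) ≡ ℤ.+ a ℤ.* ℤ.+ d ℤ.+ ℤ.+ c ℤ.* ℤ.+ b
  numerator = trans (ℤ.pos-+ (a * d) (c * b)) (cong₂ ℤ._+_ (ℤ.pos-* a d) (ℤ.pos-* c b))

/-+-same : ∀ a c b k .{{_ : NonZero b}} → a + c ≡ k * b → (ℤ.+ a ℚ./ b) ℚ.+ (ℤ.+ c ℚ./ b) ≡ nℚ k
/-+-same a c b k a+c≡kb = trans (/-+ a b c b) (/-cross (a * b + c * b) (b * b) k 1 {{ℕ.m*n≢0 b b}} (begin
  (a * b + c * b) * 1   ≡⟨ ℕ.*-identityʳ _ ⟩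
  a * b + c * b         ≡⟨ ℕ.*-distribʳ-+ b a c ⟨
  (a + c) * b           ≡⟨ cong (_* b) a+c≡kb ⟩
  k * b * b             ≡⟨ ℕ.*-assoc k b b ⟩
  k * (b * b)           ∎))
  where open ≡-Reasoning

fibRatio-inverse : ∀ s t → fibRatio (suc s) t ℚ.* fibRatio (suc t) s ≡ 1ℚ
fibRatio-inverse s t = trans
  (/-* (fib (suc s)) (fib (suc t)) (fib (suc t)) (fib (suc s)) {{fib-suc-nonZero t}} {{fib-suc-nonZero s}})
  (/-cross (fib (suc s) * fib (suc t)) (fib (suc t) * fib (suc s)) 1 1
           {{ℕ.m*n≢0 (fib (suc t)) (fib (suc s)) {{fib-suc-nonZero t}} {{fib-suc-nonZero s}}}}
     (trans (ℕ.*-identityʳ _) (trans (ℕ.*-comm (fib (suc s)) (fib (suc t))) (sym (ℕ.+-identityʳ _)))))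

fib-+3 : ∀ t → fib t + fib (3 + t) ≡ 2 * fib (2 + t)
fib-+3 t = identity (fib (suc t)) (fib t)
  where
  identity : ∀ x y → y + ((x + y) + x) ≡ 2 * (x + y)
  identity = solve-∀

fib-+4 : ∀ t → fib t + fib (4 + t) ≡ 3 * fib (2 + t)
fib-+4 t = identity (fib (suc t)) (fib t)
  where
  identity : ∀ x y → y + (((x + y) + x) + (x + y)) ≡ 3 * (x + y)
  identity = solve-∀

fibRatio-+3 : ∀ t → fibRatio t (suc t) ℚ.+ fibRatio (3 + t) (suc t) ≡ nℚ 2
fibRatio-+3 t = /-+-same (fib t) (fib (3 + t)) (fib (2 + t)) 2 {{fib-suc-nonZero (suc t)}} (fib-+3 t)

fibRatio-+4 : ∀ t → fibRatio t (suc t) ℚ.+ fibRatio (4 + t) (suc t) ≡ nℚ 3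
fibRatio-+4 t = /-+-same (fib t) (fib (4 + t)) (fib (2 + t)) 3 {{fib-suc-nonZero (suc t)}} (fib-+4 t)

-- Finite sums and matrix algebra

≡ᵇ-refl : ∀ n → (n ≡ᵇ n) ≡ true
≡ᵇ-refl n = dec-true (n ℕ.≟ n) refl

≢⇒≡ᵇ-false : ∀ {m n} → m ≢ n → (m ≡ᵇ n) ≡ false
≢⇒≡ᵇ-false {m} {n} = dec-false (m ℕ.≟ n)

if-true : ∀ {A : Set} {c} {x y : A} → c ≡ true → (if c then x else y) ≡ x
if-true refl = refl

if-false : ∀ {A : Set} {c} {x y : A} → c ≡ false → (if c then x else y) ≡ y
if-false refl = refl

sumF≡sum : ∀ {n} (f : Vector ℚ n) → sumF f ≡ sum f
sumF≡sum {zero}  f = refl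
sumF≡sum {suc n} f = cong (f Fin.zero ℚ.+_) (sumF≡sum (f ∘ Fin.suc))

sumF-cong : ∀ {n} {f g : Vector ℚ n} → (∀ k → f k ≡ g k) → sumF f ≡ sumF g
sumF-cong {f = f} {g} f≗g = trans (sumF≡sum f) (trans (sum-cong-≗ f≗g) (sym (sumF≡sum g)))

sumF-zero : ∀ {n} (f : Vector ℚ n) → (∀ k → f k ≡ 0ℚ) → sumF f ≡ 0ℚ
sumF-zero {n} f f≡0 = trans (sumF≡sum f) (trans (sum-cong-≗ f≡0) (sum-replicate-zero n))

sumF-single : ∀ {n} (f : Vector ℚ n) c → (∀ k → k ≢ c → f k ≡ 0ℚ) → sumF f ≡ f c
sumF-single f Fin.zero    f≡0 =
  trans (cong (f Fin.zero ℚ.+_) (sumF-zero (f ∘ Fin.suc) (λ k → f≡0 (Fin.suc k) λ ())))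
        (ℚ.+-identityʳ _)
sumF-single f (Fin.suc c) f≡0 =
  trans (cong₂ ℚ._+_ (f≡0 Fin.zero λ ())
                     (sumF-single (f ∘ Fin.suc) c λ k k≢c → f≡0 (Fin.suc k) (k≢c ∘ Fin.suc-injective)))
        (ℚ.+-identityˡ _)

∑< : ℕ → (ℕ → ℚ) → ℚ
∑< m g = sumF {m} (g ∘ toℕ)

∑<-cong : ∀ m {g h : ℕ → ℚ} → (∀ k → k < m → g k ≡ h k) → ∑< m g ≡ ∑< m h
∑<-cong m g≡h = sumF-cong λ k → g≡h (toℕ k) (Fin.toℕ<n k)

∑<-single : ∀ {m} (g : ℕ → ℚ) {c} → c < m → (∀ k → k ≢ c → g k ≡ 0ℚ) → ∑< m g ≡ g c
∑<-single g {c} c<m g≡0 = trans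
  (sumF-single (g ∘ toℕ) (Fin.fromℕ< c<m)
    λ k k≢c → g≡0 (toℕ k) λ k≡c → k≢c (Fin.toℕ-injective (trans k≡c (sym (Fin.toℕ-fromℕ< c<m)))))
  (cong g (Fin.toℕ-fromℕ< c<m))

∑<-zero : ∀ m {g : ℕ → ℚ} → (∀ k → g k ≡ 0ℚ) → ∑< m g ≡ 0ℚ
∑<-zero m {g} g≡0 = sumF-zero {m} (g ∘ toℕ) (g≡0 ∘ toℕ)

-- A term whose index would be m lies outside the matrix: it is dropped when the index
-- before it is the last one.
unlessLast : Bool → ℚ → ℚ
unlessLast true  _ = 0ℚ
unlessLast false x = x

∑<-pair : ∀ {m} (g : ℕ → ℚ) {c} → c < m → (∀ k → k ≢ c → k ≢ suc c → g k ≡ 0ℚ) →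
          ∑< m g ≡ g c ℚ.+ unlessLast (suc c ≡ᵇ m) (g (suc c))
∑<-pair {suc zero}    g {zero}  _         _   = refl
∑<-pair {suc (suc m)} g {zero}  _         g≡0 =
  cong (g 0 ℚ.+_) (∑<-single {suc m} (g ∘ suc) z<s λ k k≢0 → g≡0 (suc k) (λ ()) (k≢0 ∘ ℕ.suc-injective))
∑<-pair {suc m}       g {suc c} (s<s c<m) g≡0 =
  trans (cong₂ ℚ._+_ (g≡0 0 (λ ()) (λ ()))
                     (∑<-pair (g ∘ suc) c<m λ k k≢c k≢1+c →
                        g≡0 (suc k) (k≢c ∘ ℕ.suc-injective) (k≢1+c ∘ ℕ.suc-injective)))
        (ℚ.+-identityˡ _)

infix 4 _≋_
_≋_ : ∀ {n} → Mat n → Mat n → Set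
A ≋ B = ∀ i j → A i j ≡ B i j

⊗-congˡ : ∀ {n} {A A′ : Mat n} (B : Mat n) → A ≋ A′ → A ⊗ B ≋ A′ ⊗ B
⊗-congˡ B A≋A′ i j = sumF-cong λ k → cong (ℚ._* B k j) (A≋A′ i k)

⊗-congʳ : ∀ {n} (A : Mat n) {B B′ : Mat n} → B ≋ B′ → A ⊗ B ≋ A ⊗ B′
⊗-congʳ A B≋B′ i j = sumF-cong λ k → cong (A i k ℚ.*_) (B≋B′ k j)

⊗-assoc : ∀ {n} (A B C : Mat n) → (A ⊗ B) ⊗ C ≋ A ⊗ (B ⊗ C)
⊗-assoc A B C i j = begin
  sumF (λ l → sumF (λ k → A i k ℚ.* B k l) ℚ.* C l j)
    ≡⟨ sumF≡sum (λ l → sumF (λ k → A i k ℚ.* B k l) ℚ.* C l j) ⟩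
  sum (λ l → sumF (λ k → A i k ℚ.* B k l) ℚ.* C l j)
    ≡⟨ sum-cong-≗ (λ l → trans (cong (ℚ._* C l j) (sumF≡sum (λ k → A i k ℚ.* B k l)))
                                (*-distribʳ-sum (C l j) (λ k → A i k ℚ.* B k l))) ⟩
  sum (λ l → sum (λ k → A i k ℚ.* B k l ℚ.* C l j))
    ≡⟨ ∑-comm (λ l k → A i k ℚ.* B k l ℚ.* C l j) ⟩
  sum (λ k → sum (λ l → A i k ℚ.* B k l ℚ.* C l j))
    ≡⟨ sum-cong-≗ (λ k → trans (sum-cong-≗ λ l → ℚ.*-assoc (A i k) (B k l) (C l j))
                                (sym (*-distribˡ-sum (A i k) (λ l → B k l ℚ.* C l j)))) ⟩
  sum (λ k → A i k ℚ.* sum (λ l → B k l ℚ.* C l j))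
    ≡⟨ sum-cong-≗ (λ k → cong (A i k ℚ.*_) (sumF≡sum (λ l → B k l ℚ.* C l j))) ⟨
  sum (λ k → A i k ℚ.* sumF (λ l → B k l ℚ.* C l j))
    ≡⟨ sumF≡sum (λ k → A i k ℚ.* sumF (λ l → B k l ℚ.* C l j)) ⟨
  sumF (λ k → A i k ℚ.* sumF (λ l → B k l ℚ.* C l j)) ∎
  where open ≡-Reasoning

idMat-diagonal : ∀ {n} (i : Fin n) → idMat i i ≡ 1ℚ
idMat-diagonal i = if-true (≡ᵇ-refl (toℕ i))

idMat-offDiagonal : ∀ {n} {i j : Fin n} → i ≢ j → idMat i j ≡ 0ℚ
idMat-offDiagonal i≢j = if-false (≢⇒≡ᵇ-false (i≢j ∘ Fin.toℕ-injective))

⊗-identityˡ : ∀ {n} (A : Mat n) → idMat ⊗ A ≋ A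
⊗-identityˡ A i j = begin
  sumF (λ k → idMat i k ℚ.* A k j)
    ≡⟨ sumF-single _ i (λ k k≢i →
         trans (cong (ℚ._* A k j) (idMat-offDiagonal (k≢i ∘ sym))) (ℚ.*-zeroˡ (A k j))) ⟩
  idMat i i ℚ.* A i j
    ≡⟨ trans (cong (ℚ._* A i j) (idMat-diagonal i)) (ℚ.*-identityˡ (A i j)) ⟩
  A i j ∎
  where open ≡-Reasoning

⊗-identityʳ : ∀ {n} (A : Mat n) → A ⊗ idMat ≋ A
⊗-identityʳ A i j = begin
  sumF (λ k → A i k ℚ.* idMat k j)
    ≡⟨ sumF-single _ j (λ k k≢j →
         trans (cong (A i k ℚ.*_) (idMat-offDiagonal k≢j)) (ℚ.*-zeroʳ (A i k))) ⟩
  A i j ℚ.* idMat j j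
    ≡⟨ trans (cong (A i j ℚ.*_) (idMat-diagonal j)) (ℚ.*-identityʳ (A i j)) ⟩
  A i j ∎
  where open ≡-Reasoning

inverse-unique : ∀ {n} {A B C : Mat n} → A ⊗ B ≋ idMat → C ⊗ A ≋ idMat → C ≋ B
inverse-unique {A = A} {B} {C} AB≋I CA≋I i j = begin
  C i j                ≡⟨ ⊗-identityʳ C i j ⟨
  (C ⊗ idMat) i j      ≡⟨ ⊗-congʳ C AB≋I i j ⟨
  (C ⊗ (A ⊗ B)) i j    ≡⟨ ⊗-assoc C A B i j ⟨
  ((C ⊗ A) ⊗ B) i j    ≡⟨ ⊗-congˡ B CA≋I i j ⟩
  (idMat ⊗ B) i j      ≡⟨ ⊗-identityˡ B i j ⟩
  B i j                ∎
  where open ≡-Reasoning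

-- The inverse of U, and conjugation by it

Matℕ : Set
Matℕ = ℕ → ℕ → ℚ

-- U N, W N and D N are ⟦ Uℕ ⟧, ⟦ Wℕ ⟧ and ⟦ Dℕ N ⟧ by definition, and ⟦ A ⟧ ⊗ ⟦ B ⟧ is
-- ⟦ A ⊗⟨ n ⟩ B ⟧ at size n, by definition.
⟦_⟧ : ∀ {n} → Matℕ → Mat n
⟦ A ⟧ i j = A (toℕ i) (toℕ j)

_⊗⟨_⟩_ : Matℕ → ℕ → Matℕ → Matℕ
(A ⊗⟨ m ⟩ B) a b = ∑< m (λ k → A a k ℚ.* B k b)

idℕ : Matℕ
idℕ a b = if a ≡ᵇ b then 1ℚ else 0ℚ

Uℕ : Matℕ
Uℕ a b = if a ≤ᵇ b then 1ℚ else 0ℚ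

Vℕ : Matℕ
Vℕ a b = if a ≡ᵇ b then 1ℚ else if suc a ≡ᵇ b then ℚ.- 1ℚ else 0ℚ

V-diagonal : ∀ a → Vℕ a a ≡ 1ℚ
V-diagonal a = if-true (≡ᵇ-refl a)

V-super : ∀ a → Vℕ a (suc a) ≡ ℚ.- 1ℚ
V-super a = trans (if-false (≢⇒≡ᵇ-false (ℕ.<⇒≢ (ℕ.n<1+n a)))) (if-true (≡ᵇ-refl a))

V-zero : ∀ {a k} → a ≢ k → suc a ≢ k → Vℕ a k ≡ 0ℚ
V-zero a≢k 1+a≢k = trans (if-false (≢⇒≡ᵇ-false a≢k)) (if-false (≢⇒≡ᵇ-false 1+a≢k))

unlessLast-neg : ∀ l x → unlessLast l (ℚ.- x) ≡ ℚ.- unlessLast l x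
unlessLast-neg true  x = refl
unlessLast-neg false x = refl

V⊗-difference : ∀ {m} X {a} b → a < m →
                (Vℕ ⊗⟨ m ⟩ X) a b ≡ X a b ℚ.- unlessLast (suc a ≡ᵇ m) (X (suc a) b)
V⊗-difference {m} X {a} b a<m = begin
  ∑< m (λ k → Vℕ a k ℚ.* X k b)
    ≡⟨ ∑<-pair (λ k → Vℕ a k ℚ.* X k b) a<m
         (λ k k≢a k≢1+a →
            trans (cong (ℚ._* X k b) (V-zero (k≢a ∘ sym) (k≢1+a ∘ sym))) (ℚ.*-zeroˡ (X k b))) ⟩
  Vℕ a a ℚ.* X a b ℚ.+ unlessLast (suc a ≡ᵇ m) (Vℕ a (suc a) ℚ.* X (suc a) b)
    ≡⟨ cong₂ (λ x y → x ℚ.+ unlessLast (suc a ≡ᵇ m) y)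
         (trans (cong (ℚ._* X a b) (V-diagonal a)) (ℚ.*-identityˡ (X a b)))
         (trans (cong (ℚ._* X (suc a) b) (V-super a)) (-1*x≈-x (X (suc a) b))) ⟩
  X a b ℚ.+ unlessLast (suc a ≡ᵇ m) (ℚ.- X (suc a) b)
    ≡⟨ cong (X a b ℚ.+_) (unlessLast-neg (suc a ≡ᵇ m) (X (suc a) b)) ⟩
  X a b ℚ.- unlessLast (suc a ≡ᵇ m) (X (suc a) b) ∎
  where open ≡-Reasoning

⊗Vᵗ-difference : ∀ {m} X a {b} → b < m →
                 (X ⊗⟨ m ⟩ flip Vℕ) a b ≡ X a b ℚ.- unlessLast (suc b ≡ᵇ m) (X a (suc b))
⊗Vᵗ-difference {m} X a {b} b<m = trans
  (∑<-cong m λ k _ → ℚ.*-comm (X a k) (Vℕ b k))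
  (V⊗-difference (flip X) a b<m)

U-suc : ∀ a b → Uℕ (suc a) (suc b) ≡ Uℕ a b
U-suc zero    b = refl
U-suc (suc a) b = refl

U-lower : ∀ {a b} → b ≤ a → Uℕ a b ≡ idℕ a b
U-lower {zero}  z≤n       = refl
U-lower {suc a} z≤n       = refl
U-lower {suc a} (s≤s b≤a) = trans (U-suc a _) (U-lower b≤a)

U-columnStep : ∀ a c → Uℕ a (suc c) ℚ.- Uℕ a c ≡ idℕ a (suc c)
U-columnStep zero          c       = refl
U-columnStep (suc zero)    zero    = refl
U-columnStep (suc (suc a)) zero    = refl
U-columnStep (suc a)       (suc c) =
  trans (cong₂ ℚ._-_ (U-suc a (suc c)) (U-suc a c)) (U-columnStep a c)

U-rowStep : ∀ a b → Uℕ a b ℚ.- Uℕ (suc a) b ≡ idℕ a b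
U-rowStep zero    zero    = refl
U-rowStep zero    (suc b) = refl
U-rowStep (suc a) zero    = refl
U-rowStep (suc a) (suc b) =
  trans (cong₂ ℚ._-_ (U-suc a b) (U-suc (suc a) b)) (U-rowStep a b)

isLast : ∀ {m a} → suc a ≡ m → (suc a ≡ᵇ m) ≡ true
isLast {a = a} refl = ≡ᵇ-refl (suc a)

isNotLast : ∀ {m a} → suc a < m → (suc a ≡ᵇ m) ≡ false
isNotLast 1+a<m = ≢⇒≡ᵇ-false (ℕ.<⇒≢ 1+a<m)

U⊗V≡id : ∀ {m} a {b} → b < m → (Uℕ ⊗⟨ m ⟩ Vℕ) a b ≡ idℕ a b
U⊗V≡id {m} a {zero} 0<m = begin
  ∑< m (λ k → Uℕ a k ℚ.* Vℕ k 0)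
    ≡⟨ ∑<-single (λ k → Uℕ a k ℚ.* Vℕ k 0) 0<m
         (λ k k≢0 → trans (cong (Uℕ a k ℚ.*_) (V-zero k≢0 λ ())) (ℚ.*-zeroʳ (Uℕ a k))) ⟩
  Uℕ a 0 ℚ.* 1ℚ
    ≡⟨ trans (ℚ.*-identityʳ (Uℕ a 0)) (U-lower {a} z≤n) ⟩
  idℕ a 0 ∎
  where open ≡-Reasoning
U⊗V≡id {m} a {suc c} 1+c<m = begin
  ∑< m (λ k → Uℕ a k ℚ.* Vℕ k (suc c))
    ≡⟨ ∑<-pair (λ k → Uℕ a k ℚ.* Vℕ k (suc c)) (ℕ.<-trans (ℕ.n<1+n c) 1+c<m)
         (λ k k≢c k≢1+c →
            trans (cong (Uℕ a k ℚ.*_) (V-zero k≢1+c (k≢c ∘ ℕ.suc-injective))) (ℚ.*-zeroʳ (Uℕ a k))) ⟩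
  Uℕ a c ℚ.* Vℕ c (suc c) ℚ.+ unlessLast (suc c ≡ᵇ m) (Uℕ a (suc c) ℚ.* Vℕ (suc c) (suc c))
    ≡⟨ cong₂ (λ x l → x ℚ.+ unlessLast l (Uℕ a (suc c) ℚ.* Vℕ (suc c) (suc c)))
         (trans (cong (Uℕ a c ℚ.*_) (V-super c)) (trans (ℚ.*-comm (Uℕ a c) _) (-1*x≈-x (Uℕ a c))))
         (isNotLast 1+c<m) ⟩
  ℚ.- Uℕ a c ℚ.+ Uℕ a (suc c) ℚ.* Vℕ (suc c) (suc c)
    ≡⟨ trans (cong (ℚ.- Uℕ a c ℚ.+_) (trans (cong (Uℕ a (suc c) ℚ.*_) (V-diagonal (suc c))) (ℚ.*-identityʳ _)))
             (ℚ.+-comm (ℚ.- Uℕ a c) (Uℕ a (suc c))) ⟩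
  Uℕ a (suc c) ℚ.- Uℕ a c
    ≡⟨ U-columnStep a c ⟩
  idℕ a (suc c) ∎
  where open ≡-Reasoning

V⊗U≡id : ∀ {m a b} → a < m → b < m → (Vℕ ⊗⟨ m ⟩ Uℕ) a b ≡ idℕ a b
V⊗U≡id {m} {a} {b} a<m b<m =
  trans (V⊗-difference Uℕ b a<m) ([ inner , last ]′ (ℕ.m≤n⇒m<n∨m≡n a<m))
  where
  inner : suc a < m → Uℕ a b ℚ.- unlessLast (suc a ≡ᵇ m) (Uℕ (suc a) b) ≡ idℕ a b
  inner 1+a<m = trans (cong (λ l → Uℕ a b ℚ.- unlessLast l (Uℕ (suc a) b)) (isNotLast 1+a<m)) (U-rowStep a b)
  last : suc a ≡ m → Uℕ a b ℚ.- unlessLast (suc a ≡ᵇ m) (Uℕ (suc a) b) ≡ idℕ a b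
  last 1+a≡m = trans (cong (λ l → Uℕ a b ℚ.- unlessLast l (Uℕ (suc a) b)) (isLast 1+a≡m))
                     (trans (ℚ.+-identityʳ (Uℕ a b)) (U-lower (ℕ.≤-pred (subst (b <_) (sym 1+a≡m) b<m))))

Δ² : Bool → Bool → ℚ → ℚ → ℚ → ℚ → ℚ
Δ² lastA lastB x₀₀ x₁₀ x₀₁ x₁₁ =
  (x₀₀ ℚ.- unlessLast lastA x₁₀) ℚ.- unlessLast lastB (x₀₁ ℚ.- unlessLast lastA x₁₁)

V-conjugate : ∀ {m} X {a b} → a < m → b < m →
  ((Vℕ ⊗⟨ m ⟩ X) ⊗⟨ m ⟩ flip Vℕ) a b
  ≡ Δ² (suc a ≡ᵇ m) (suc b ≡ᵇ m) (X a b) (X (suc a) b) (X a (suc b)) (X (suc a) (suc b))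
V-conjugate {m} X {a} {b} a<m b<m = trans (⊗Vᵗ-difference (Vℕ ⊗⟨ m ⟩ X) a b<m)
  (cong₂ (λ x y → x ℚ.- unlessLast (suc b ≡ᵇ m) y) (V⊗-difference X b a<m) (V⊗-difference X (suc b) a<m))

-- The tridiagonal matrix W D ᵗW

w : ℕ → ℚ
w b = fibRatio (1 + 2 * b) (2 + 2 * b)

Wℕ : Matℕ
Wℕ a b = if a ≡ᵇ b then 1ℚ else if a ≡ᵇ suc b then w b else 0ℚ

W-diagonal : ∀ a → Wℕ a a ≡ 1ℚ
W-diagonal a = if-true (≡ᵇ-refl a)

W-sub : ∀ b → Wℕ (suc b) b ≡ w b
W-sub b = trans (if-false (≢⇒≡ᵇ-false (ℕ.1+n≢n {b}))) (if-true (≡ᵇ-refl b))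

W-zero : ∀ {a k} → a ≢ k → a ≢ suc k → Wℕ a k ≡ 0ℚ
W-zero a≢k a≢1+k = trans (if-false (≢⇒≡ᵇ-false a≢k)) (if-false (≢⇒≡ᵇ-false a≢1+k))

module _ (N : ℕ) where

  private
    m = N / 2

  δ : ℕ → ℚ
  δ a = if suc a ≡ᵇ m then fibRatio N (2 * a) else fibRatio (3 + 2 * a) (2 * a)

  Dℕ : Matℕ
  Dℕ a b = if a ≡ᵇ b then δ a else 0ℚ

  WDWᵗ : Matℕ
  WDWᵗ = (Wℕ ⊗⟨ m ⟩ Dℕ) ⊗⟨ m ⟩ flip Wℕ

  δ-inner : ∀ {a} → suc a < m → δ a ≡ fibRatio (3 + 2 * a) (2 * a)
  δ-inner 1+a<m = if-false (isNotLast 1+a<m)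

  δ-last : ∀ {a} → suc a ≡ m → δ a ≡ fibRatio N (2 * a)
  δ-last 1+a≡m = if-true (isLast 1+a≡m)

  w*δ≡1 : ∀ {a} → suc a < m → w a ℚ.* δ a ≡ 1ℚ
  w*δ≡1 {a} 1+a<m = trans (cong (w a ℚ.*_) (δ-inner 1+a<m)) (fibRatio-inverse (2 * a) (2 + 2 * a))

  WDWᵗ-entry : ∀ x y → WDWᵗ x y ≡ ∑< m (λ k → Wℕ x k ℚ.* δ k ℚ.* Wℕ y k)
  WDWᵗ-entry x y = ∑<-cong m λ k k<m → cong (ℚ._* Wℕ y k) (trans
    (∑<-single (λ l → Wℕ x l ℚ.* Dℕ l k) k<m
      λ l l≢k → trans (cong (λ b → Wℕ x l ℚ.* (if b then δ l else 0ℚ)) (≢⇒≡ᵇ-false l≢k))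
                      (ℚ.*-zeroʳ (Wℕ x l)))
    (cong (λ b → Wℕ x k ℚ.* (if b then δ k else 0ℚ)) (≡ᵇ-refl k)))

  private
    term : ℕ → ℕ → ℕ → ℚ
    term x y k = Wℕ x k ℚ.* δ k ℚ.* Wℕ y k

    term-zeroˡ : ∀ x y k → Wℕ x k ≡ 0ℚ → term x y k ≡ 0ℚ
    term-zeroˡ x y k Wxk≡0 = begin
      Wℕ x k ℚ.* δ k ℚ.* Wℕ y k  ≡⟨ cong (λ t → t ℚ.* δ k ℚ.* Wℕ y k) Wxk≡0 ⟩
      0ℚ ℚ.* δ k ℚ.* Wℕ y k      ≡⟨ cong (ℚ._* Wℕ y k) (ℚ.*-zeroˡ (δ k)) ⟩
      0ℚ ℚ.* Wℕ y k              ≡⟨ ℚ.*-zeroˡ (Wℕ y k) ⟩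
      0ℚ                         ∎
      where open ≡-Reasoning

    term-zeroʳ : ∀ x y k → Wℕ y k ≡ 0ℚ → term x y k ≡ 0ℚ
    term-zeroʳ x y k Wyk≡0 = trans (cong (Wℕ x k ℚ.* δ k ℚ.*_) Wyk≡0) (ℚ.*-zeroʳ (Wℕ x k ℚ.* δ k))

    term-unit : ∀ x y k → Wℕ x k ≡ 1ℚ → Wℕ y k ≡ 1ℚ → term x y k ≡ δ k
    term-unit x y k Wxk≡1 Wyk≡1 = begin
      Wℕ x k ℚ.* δ k ℚ.* Wℕ y k  ≡⟨ cong₂ (λ s t → s ℚ.* δ k ℚ.* t) Wxk≡1 Wyk≡1 ⟩
      1ℚ ℚ.* δ k ℚ.* 1ℚ          ≡⟨ ℚ.*-identityʳ _ ⟩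
      1ℚ ℚ.* δ k                 ≡⟨ ℚ.*-identityˡ (δ k) ⟩
      δ k                        ∎
      where open ≡-Reasoning

  WDWᵗ-symmetric : ∀ x y → WDWᵗ x y ≡ WDWᵗ y x
  WDWᵗ-symmetric x y = begin
    WDWᵗ x y                                ≡⟨ WDWᵗ-entry x y ⟩
    ∑< m (λ k → Wℕ x k ℚ.* δ k ℚ.* Wℕ y k)  ≡⟨ ∑<-cong m (λ k _ → swap (Wℕ x k) (δ k) (Wℕ y k)) ⟩
    ∑< m (λ k → Wℕ y k ℚ.* δ k ℚ.* Wℕ x k)  ≡⟨ WDWᵗ-entry y x ⟨
    WDWᵗ y x                                ∎
    where
    open ≡-Reasoning
    swap : ∀ a d b → a ℚ.* d ℚ.* b ≡ b ℚ.* d ℚ.* a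
    swap a d b = trans (ℚ.*-comm (a ℚ.* d) b) (trans (cong (b ℚ.*_) (ℚ.*-comm a d)) (sym (ℚ.*-assoc b d a)))

  WDWᵗ-far : ∀ {x y} → suc (suc x) ≤ y → WDWᵗ x y ≡ 0ℚ
  WDWᵗ-far {x} {y} 2+x≤y = trans (WDWᵗ-entry x y) (∑<-zero m term≡0)
    where
    term≡0 : ∀ k → term x y k ≡ 0ℚ
    term≡0 k = [ zeroʳ , zeroˡ ]′ (ℕ.≤-<-connex k x)
      where
      zeroʳ : k ≤ x → term x y k ≡ 0ℚ
      zeroʳ k≤x = term-zeroʳ x y k (W-zero {y} {k} (ℕ.>⇒≢ (ℕ.<-≤-trans (s≤s k≤x) (ℕ.<⇒≤ 2+x≤y)))
                                                   (ℕ.>⇒≢ (ℕ.<-≤-trans (s≤s (s≤s k≤x)) 2+x≤y)))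
      zeroˡ : x < k → term x y k ≡ 0ℚ
      zeroˡ x<k = term-zeroˡ x y k (W-zero {x} {k} (ℕ.<⇒≢ x<k) (ℕ.<⇒≢ (ℕ.<-trans x<k (ℕ.n<1+n k))))

  WDWᵗ-super : ∀ {x} → suc x < m → WDWᵗ x (suc x) ≡ 1ℚ
  WDWᵗ-super {x} 1+x<m = begin
    WDWᵗ x (suc x)                      ≡⟨ WDWᵗ-entry x (suc x) ⟩
    ∑< m (term x (suc x))               ≡⟨ ∑<-single (term x (suc x)) (ℕ.<-trans (ℕ.n<1+n x) 1+x<m) term≡0 ⟩
    term x (suc x) x                    ≡⟨ cong₂ (λ s t → s ℚ.* δ x ℚ.* t) (W-diagonal x) (W-sub x) ⟩
    1ℚ ℚ.* δ x ℚ.* w x                  ≡⟨ cong (ℚ._* w x) (ℚ.*-identityˡ (δ x)) ⟩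
    δ x ℚ.* w x                         ≡⟨ trans (ℚ.*-comm (δ x) (w x)) (w*δ≡1 1+x<m) ⟩
    1ℚ                                  ∎
    where
    open ≡-Reasoning
    term≡0 : ∀ k → k ≢ x → term x (suc x) k ≡ 0ℚ
    term≡0 k k≢x = [ zeroʳ , zeroˡ ]′ (ℕ.≤-<-connex k x)
      where
      zeroʳ : k ≤ x → term x (suc x) k ≡ 0ℚ
      zeroʳ k≤x = term-zeroʳ x (suc x) k (W-zero {suc x} {k} (ℕ.>⇒≢ (s≤s k≤x)) (k≢x ∘ sym ∘ ℕ.suc-injective))
      zeroˡ : x < k → term x (suc x) k ≡ 0ℚ
      zeroˡ x<k = term-zeroˡ x (suc x) k (W-zero {x} {k} (ℕ.<⇒≢ x<k) (ℕ.<⇒≢ (ℕ.<-trans x<k (ℕ.n<1+n k))))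

  WDWᵗ-sub : ∀ {x} → suc x < m → WDWᵗ (suc x) x ≡ 1ℚ
  WDWᵗ-sub {x} 1+x<m = trans (WDWᵗ-symmetric (suc x) x) (WDWᵗ-super 1+x<m)

  WDWᵗ-below : ∀ {x y} → suc (suc y) ≤ x → WDWᵗ x y ≡ 0ℚ
  WDWᵗ-below {x} {y} 2+y≤x = trans (WDWᵗ-symmetric x y) (WDWᵗ-far 2+y≤x)

  WDWᵗ-first : 1 < m → WDWᵗ 0 0 ≡ nℚ 2
  WDWᵗ-first 1<m = begin
    WDWᵗ 0 0              ≡⟨ WDWᵗ-entry 0 0 ⟩
    ∑< m (term 0 0)       ≡⟨ ∑<-single (term 0 0) (ℕ.<-trans z<s 1<m)
                               (λ k k≢0 → term-zeroˡ 0 0 k (W-zero (k≢0 ∘ sym) λ ())) ⟩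
    term 0 0 0            ≡⟨ term-unit 0 0 0 refl refl ⟩
    δ 0                   ≡⟨ δ-inner 1<m ⟩
    nℚ 2                  ∎
    where open ≡-Reasoning

  WDWᵗ-diagonal : ∀ {x} → suc x < m → WDWᵗ (suc x) (suc x) ≡ w x ℚ.+ δ (suc x)
  WDWᵗ-diagonal {x} 1+x<m = begin
    WDWᵗ (suc x) (suc x)
      ≡⟨ WDWᵗ-entry (suc x) (suc x) ⟩
    ∑< m (term (suc x) (suc x))
      ≡⟨ ∑<-pair (term (suc x) (suc x)) (ℕ.<-trans (ℕ.n<1+n x) 1+x<m)
           (λ k k≢x k≢1+x →
              term-zeroˡ (suc x) (suc x) k (W-zero (k≢1+x ∘ sym) (k≢x ∘ sym ∘ ℕ.suc-injective))) ⟩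
    term (suc x) (suc x) x ℚ.+ unlessLast (suc x ≡ᵇ m) (term (suc x) (suc x) (suc x))
      ≡⟨ cong₂ (λ s l → s ℚ.+ unlessLast l (term (suc x) (suc x) (suc x))) left-term (isNotLast 1+x<m) ⟩
    w x ℚ.+ term (suc x) (suc x) (suc x)
      ≡⟨ cong (w x ℚ.+_) (term-unit (suc x) (suc x) (suc x) (W-diagonal (suc x)) (W-diagonal (suc x))) ⟩
    w x ℚ.+ δ (suc x) ∎
    where
    open ≡-Reasoning
    left-term : term (suc x) (suc x) x ≡ w x
    left-term = begin
      Wℕ (suc x) x ℚ.* δ x ℚ.* Wℕ (suc x) x  ≡⟨ cong (λ s → s ℚ.* δ x ℚ.* s) (W-sub x) ⟩
      w x ℚ.* δ x ℚ.* w x                    ≡⟨ cong (ℚ._* w x) (w*δ≡1 1+x<m) ⟩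
      1ℚ ℚ.* w x                             ≡⟨ ℚ.*-identityˡ (w x) ⟩
      w x                                    ∎

  WDWᵗ-interior : ∀ {x} → suc (suc x) < m → WDWᵗ (suc x) (suc x) ≡ nℚ 3
  WDWᵗ-interior {x} 2+x<m = begin
    WDWᵗ (suc x) (suc x)                               ≡⟨ WDWᵗ-diagonal (ℕ.<-trans (ℕ.n<1+n _) 2+x<m) ⟩
    w x ℚ.+ δ (suc x)                                  ≡⟨ cong (w x ℚ.+_) (δ-inner 2+x<m) ⟩
    w x ℚ.+ fibRatio (3 + 2 * suc x) (2 * suc x)       ≡⟨ cong (λ n → w x ℚ.+ fibRatio (3 + n) n) (ℕ.*-suc 2 x) ⟩
    w x ℚ.+ fibRatio (5 + 2 * x) (2 + 2 * x)           ≡⟨ fibRatio-+4 (1 + 2 * x) ⟩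
    nℚ 3                                               ∎
    where open ≡-Reasoning

  WDWᵗ-last : ∀ {x} → suc (suc x) ≡ m → WDWᵗ (suc x) (suc x) ≡ w x ℚ.+ fibRatio N (2 + 2 * x)
  WDWᵗ-last {x} 2+x≡m = begin
    WDWᵗ (suc x) (suc x)                  ≡⟨ WDWᵗ-diagonal (ℕ.≤-reflexive 2+x≡m) ⟩
    w x ℚ.+ δ (suc x)                     ≡⟨ cong (w x ℚ.+_) (δ-last 2+x≡m) ⟩
    w x ℚ.+ fibRatio N (2 * suc x)        ≡⟨ cong (λ n → w x ℚ.+ fibRatio N n) (ℕ.*-suc 2 x) ⟩
    w x ℚ.+ fibRatio N (2 + 2 * x)        ∎
    where open ≡-Reasoning

  WDWᵗ-last-odd : ∀ {x} → suc (suc x) ≡ m → N ≡ 5 + 2 * x → WDWᵗ (suc x) (suc x) ≡ nℚ 3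
  WDWᵗ-last-odd {x} 2+x≡m N≡5+2x =
    trans (WDWᵗ-last 2+x≡m) (trans (cong (λ n → w x ℚ.+ fibRatio n (2 + 2 * x)) N≡5+2x) (fibRatio-+4 (1 + 2 * x)))

  WDWᵗ-last-even : ∀ {x} → suc (suc x) ≡ m → N ≡ 4 + 2 * x → WDWᵗ (suc x) (suc x) ≡ nℚ 2
  WDWᵗ-last-even {x} 2+x≡m N≡4+2x =
    trans (WDWᵗ-last 2+x≡m) (trans (cong (λ n → w x ℚ.+ fibRatio n (2 + 2 * x)) N≡4+2x) (fibRatio-+3 (1 + 2 * x)))

-- The circulant Laplacian of C_N²

-- lapC N u v reduces to lap₀ N (diffMod N u v).
lap₀ : ℕ → ℕ → ℚ
lap₀ N d = (if d ≡ᵇ 0 then nℚ 4 else 0ℚ)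
         ℚ.- (if (d ≡ᵇ 1) ∨ (d ≡ᵇ 2) ∨ (d ≡ᵇ (N ∸ 1)) ∨ (d ≡ᵇ (N ∸ 2)) then 1ℚ else 0ℚ)

lap₀-0 : ∀ {N} → 5 ≤ N → lap₀ N 0 ≡ nℚ 4
lap₀-0 (s≤s (s≤s (s≤s (s≤s (s≤s _))))) = refl

lap₀-1 : ∀ {N} → 5 ≤ N → lap₀ N 1 ≡ ℚ.- 1ℚ
lap₀-1 (s≤s (s≤s (s≤s (s≤s (s≤s _))))) = refl

lap₀-2 : ∀ {N} → 5 ≤ N → lap₀ N 2 ≡ ℚ.- 1ℚ
lap₀-2 (s≤s (s≤s (s≤s (s≤s (s≤s _))))) = refl

lap₀-wrap₁ : ∀ {N d} → 5 ≤ N → suc d ≡ N → lap₀ N d ≡ ℚ.- 1ℚ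
lap₀-wrap₁ (s≤s (s≤s (s≤s (s≤s (s≤s {n = n} _))))) refl rewrite ≡ᵇ-refl n = refl

lap₀-wrap₂ : ∀ {N d} → 5 ≤ N → 2 + d ≡ N → lap₀ N d ≡ ℚ.- 1ℚ
lap₀-wrap₂ (s≤s (s≤s (s≤s (s≤s (s≤s {n = n} _))))) refl
  rewrite ≢⇒≡ᵇ-false (ℕ.<⇒≢ (ℕ.n<1+n n)) | ≡ᵇ-refl n = refl

lap₀-far : ∀ {N d} → 3 ≤ d → d + 3 ≤ N → lap₀ N d ≡ 0ℚ
lap₀-far {N} {d@(suc (suc (suc _)))} (s≤s (s≤s (s≤s _))) d+3≤N =
  lap₀-below-wrap (ℕ.m+n≤o⇒m≤o∸n (suc d) (subst (_≤ N) (ℕ.+-suc d 2) d+3≤N))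
  where
  lap₀-below-wrap : d < N ∸ 2 → lap₀ N d ≡ 0ℚ
  lap₀-below-wrap d<N∸2
    rewrite ≢⇒≡ᵇ-false (ℕ.<⇒≢ (ℕ.<-≤-trans d<N∸2 (ℕ.∸-monoʳ-≤ N (s≤s (z≤n {1})))))
          | ≢⇒≡ᵇ-false (ℕ.<⇒≢ d<N∸2) = refl

module _ (N : ℕ) .{{_ : NonZero N}} where

  diffMod-+ : ∀ d v → d < N → diffMod N (d + v) v ≡ d
  diffMod-+ d v d<N = begin
    (ℤ.+ (d + v) ℤ.- ℤ.+ v) %ℕ N   ≡⟨ cong (_%ℕ N) (ℤ.m-n≡m⊖n (d + v) v) ⟩
    ((d + v) ℤ.⊖ v) %ℕ N           ≡⟨ cong (_%ℕ N) (ℤ.⊖-≥ (ℕ.m≤n+m v d)) ⟩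
    ℤ.+ (d + v ∸ v) %ℕ N           ≡⟨ cong (λ n → ℤ.+ n %ℕ N) (ℕ.m+n∸n≡m d v) ⟩
    ℤ.+ d %ℕ N                     ≡⟨ m<n⇒m%n≡m d<N ⟩
    d                              ∎
    where open ≡-Reasoning

  diffMod-∸ : ∀ d v → suc d < N → diffMod N v (suc d + v) ≡ N ∸ suc d
  diffMod-∸ d v 1+d<N = begin
    (ℤ.+ v ℤ.- ℤ.+ (suc d + v)) %ℕ N   ≡⟨ cong (_%ℕ N) (ℤ.m-n≡m⊖n v (suc d + v)) ⟩
    (v ℤ.⊖ (suc d + v)) %ℕ N           ≡⟨ cong (_%ℕ N) (ℤ.⊖-≤ (ℕ.m≤n+m v (suc d))) ⟩
    ℤ.- ℤ.+ (suc d + v ∸ v) %ℕ N       ≡⟨ cong (λ n → ℤ.- ℤ.+ n %ℕ N) (ℕ.m+n∸n≡m (suc d) v) ⟩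
    -[1+ d ] %ℕ N                      ≡⟨ negative-mod ⟩
    N ∸ suc d                          ∎
    where
    open ≡-Reasoning
    negative-mod : -[1+ d ] %ℕ N ≡ N ∸ suc d
    negative-mod rewrite m<n⇒m%n≡m 1+d<N = refl

  lap'-below : ∀ d v → d + v < N → lap' N (d + v) v ≡ lap₀ N d
  lap'-below d v d+v<N = cong (lap₀ N) (diffMod-+ d v (ℕ.≤-<-trans (ℕ.m≤m+n d v) d+v<N))

  lap'-above : ∀ d v → suc d + v < N → lap' N v (suc d + v) ≡ lap₀ N (N ∸ suc d)
  lap'-above d v 1+d+v<N = cong (lap₀ N) (diffMod-∸ d v (ℕ.≤-<-trans (ℕ.m≤m+n (suc d) v) 1+d+v<N))

  lap'-diagonal : ∀ v → v < N → lap' N v v ≡ lap₀ N 0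
  lap'-diagonal = lap'-below 0

  lap'-reflected : ∀ {I J} → I + suc J < N → lap' N I (N ∸ suc J) ≡ lap₀ N (I + suc J)
  lap'-reflected {I} {J} I+J<N = begin
    lap' N I (N ∸ suc J)                ≡⟨ cong (lap' N I) N∸J≡s+I ⟩
    lap' N I (suc s + I)                ≡⟨ lap'-above s I s+I<N ⟩
    lap₀ N (N ∸ suc s)                  ≡⟨ cong (λ n → lap₀ N (n ∸ suc s)) (sym I+J+s≡N) ⟩
    lap₀ N (I + suc J + suc s ∸ suc s)  ≡⟨ cong (lap₀ N) (ℕ.m+n∸n≡m (I + suc J) (suc s)) ⟩
    lap₀ N (I + suc J)                  ∎
    where
    open ≡-Reasoning
    s = N ∸ suc (I + suc J)
    I+J+s≡N : I + suc J + suc s ≡ N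
    I+J+s≡N = trans (ℕ.+-suc (I + suc J) s) (ℕ.m+[n∸m]≡n I+J<N)
    rearrange : ∀ a b c → b + a + c ≡ a + c + b
    rearrange = solve-∀
    s+I+J≡N : suc s + I + suc J ≡ N
    s+I+J≡N = trans (rearrange I (suc s) (suc J)) I+J+s≡N
    s+I<N : suc s + I < N
    s+I<N = ℕ.<-≤-trans (ℕ.m<m+n (suc s + I) z<s) (ℕ.≤-reflexive s+I+J≡N)
    N∸J≡s+I : N ∸ suc J ≡ suc s + I
    N∸J≡s+I = trans (cong (_∸ suc J) (sym s+I+J≡N)) (ℕ.m+n∸n≡m (suc s + I) (suc J))

-- Entrywise comparison

-- With I = suc (toℕ i) and J = suc (toℕ j), H N i j reduces to
-- foldedEntry (N % 2 ≡ᵇ 1) (J ≡ᵇ N / 2) (I ≡ᵇ N / 2) (lap' N I J) (lap' N I (N ∸ J)) (lap' N I (N / 2)).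
foldedEntry : Bool → Bool → Bool → ℚ → ℚ → ℚ → ℚ
foldedEntry odd lastJ lastI ℓ₁ ℓ₂ ℓ₃ =
  let entry = if odd then ℓ₁ ℚ.+ ℓ₂ else (if lastJ then ℓ₃ else ℓ₁ ℚ.+ ℓ₂)
  in if odd then entry else (if lastI then ½ ℚ.* entry else entry)

foldedEntry-inner : ∀ odd ℓ₁ ℓ₂ ℓ₃ → foldedEntry odd false false ℓ₁ ℓ₂ ℓ₃ ≡ ℓ₁ ℚ.+ ℓ₂
foldedEntry-inner true  _ _ _ = refl
foldedEntry-inner false _ _ _ = refl

module Folded (N : ℕ) .{{_ : NonZero N}} (5≤N : 5 ≤ N) where

  m : ℕ
  m = N / 2

  x*2≡x+x : ∀ x → x * 2 ≡ x + x
  x*2≡x+x = solve-∀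

  data Parity : Bool → Set where
    odd  : N ≡ suc (m + m) → Parity true
    even : N ≡ m + m → Parity false

  parity : Parity (N % 2 ≡ᵇ 1)
  parity with N % 2 | m%n<n N 2 | m≡m%n+[m/n]*n N 2
  ... | 0           | _            | N≡m*2   = even (trans N≡m*2 (x*2≡x+x m))
  ... | 1           | _            | N≡1+m*2 = odd (trans N≡1+m*2 (cong suc (x*2≡x+x m)))
  ... | suc (suc _) | s≤s (s≤s ()) | _

  m+m≤N : ∀ {o} → Parity o → m + m ≤ N
  m+m≤N (odd N≡1+2m) = ℕ.≤-trans (ℕ.n≤1+n _) (ℕ.≤-reflexive (sym N≡1+2m))
  m+m≤N (even N≡2m)  = ℕ.≤-reflexive (sym N≡2m)

  2≤m : 2 ≤ m
  2≤m = half (4≤m+m parity)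
    where
    4≤m+m : ∀ {o} → Parity o → 4 ≤ m + m
    4≤m+m (odd N≡1+2m) = ℕ.≤-pred (subst (5 ≤_) N≡1+2m 5≤N)
    4≤m+m (even N≡2m)  = ℕ.≤-trans (ℕ.n≤1+n 4) (subst (5 ≤_) N≡2m 5≤N)
    half : ∀ {x} → 4 ≤ x + x → 2 ≤ x
    half {suc (suc _)} _ = s≤s (s≤s z≤n)
    half {suc zero} (s≤s (s≤s ()))

  m<N : m < N
  m<N = ℕ.<-≤-trans (ℕ.m<m+n m (ℕ.<-≤-trans z<s 2≤m)) (m+m≤N parity)

  M : Matℕ
  M = WDWᵗ N

  ΔM : ℕ → ℕ → ℚ
  ΔM a b = Δ² (suc a ≡ᵇ m) (suc b ≡ᵇ m) (M a b) (M (suc a) b) (M a (suc b)) (M (suc a) (suc b))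

  Goal : Bool → ℕ → ℕ → Set
  Goal o a b =
    ΔM a b ≡ foldedEntry o (suc b ≡ᵇ m) (suc a ≡ᵇ m)
        (lap' N (suc a) (suc b)) (lap' N (suc a) (N ∸ suc b)) (lap' N (suc a) m)

  -- Once the guards, the 2 × 2 window of M and the Laplacian entries are evaluated, both
  -- sides are rational literals and the remaining equation holds by computation.
  window : ∀ {o a b lastA lastB x₀₀ x₁₀ x₀₁ x₁₁ ℓ₁ ℓ₂ ℓ₃} →
    (suc a ≡ᵇ m) ≡ lastA → (suc b ≡ᵇ m) ≡ lastB →
    M a b ≡ x₀₀ → M (suc a) b ≡ x₁₀ → M a (suc b) ≡ x₀₁ → M (suc a) (suc b) ≡ x₁₁ →
    lap' N (suc a) (suc b) ≡ ℓ₁ → lap' N (suc a) (N ∸ suc b) ≡ ℓ₂ → lap' N (suc a) m ≡ ℓ₃ →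
    Δ² lastA lastB x₀₀ x₁₀ x₀₁ x₁₁ ≡ foldedEntry o lastB lastA ℓ₁ ℓ₂ ℓ₃ → Goal o a b
  window refl refl refl refl refl refl refl refl refl values = values

  window-inner : ∀ {o a b x₀₀ x₁₀ x₀₁ x₁₁ ℓ₁ ℓ₂} → suc a < m → suc b < m →
    M a b ≡ x₀₀ → M (suc a) b ≡ x₁₀ → M a (suc b) ≡ x₀₁ → M (suc a) (suc b) ≡ x₁₁ →
    lap' N (suc a) (suc b) ≡ ℓ₁ → lap' N (suc a) (N ∸ suc b) ≡ ℓ₂ →
    Δ² false false x₀₀ x₁₀ x₀₁ x₁₁ ≡ ℓ₁ ℚ.+ ℓ₂ → Goal o a b
  window-inner {o} {a} {ℓ₁ = ℓ₁} {ℓ₂} 1+a<m 1+b<m M₀₀ M₁₀ M₀₁ M₁₁ L₁ L₂ values =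
    window {o} (isNotLast 1+a<m) (isNotLast 1+b<m) M₀₀ M₁₀ M₀₁ M₁₁ L₁ L₂ refl
      (trans values (sym (foldedEntry-inner o ℓ₁ ℓ₂ (lap' N (suc a) m))))

  <N : ∀ {x} → x ≤ m → x < N
  <N x≤m = ℕ.≤-<-trans x≤m m<N

  L-diagonal : ∀ {I} → I ≤ m → lap' N I I ≡ nℚ 4
  L-diagonal I≤m = trans (lap'-diagonal N _ (<N I≤m)) (lap₀-0 5≤N)

  L-above₁ : ∀ {I} → suc I ≤ m → lap' N I (suc I) ≡ ℚ.- 1ℚ
  L-above₁ 1+I≤m = trans (lap'-above N 0 _ (<N 1+I≤m))
                         (lap₀-wrap₁ 5≤N (ℕ.m+[n∸m]≡n (ℕ.≤-trans (s≤s z≤n) 5≤N)))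

  L-above₂ : ∀ {I} → 2 + I ≤ m → lap' N I (2 + I) ≡ ℚ.- 1ℚ
  L-above₂ 2+I≤m = trans (lap'-above N 1 _ (<N 2+I≤m))
                         (lap₀-wrap₂ 5≤N (ℕ.m+[n∸m]≡n (ℕ.≤-trans (s≤s (s≤s z≤n)) 5≤N)))

  L-below₁ : ∀ {I} → suc I ≤ m → lap' N (suc I) I ≡ ℚ.- 1ℚ
  L-below₁ 1+I≤m = trans (lap'-below N 1 _ (<N 1+I≤m)) (lap₀-1 5≤N)

  L-below₂ : ∀ {I} → 2 + I ≤ m → lap' N (2 + I) I ≡ ℚ.- 1ℚ
  L-below₂ 2+I≤m = trans (lap'-below N 2 _ (<N 2+I≤m)) (lap₀-2 5≤N)

  L-reflected-far : ∀ {I J} → 3 ≤ I + suc J → 3 + (I + suc J) ≤ N → lap' N I (N ∸ suc J) ≡ 0ℚ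
  L-reflected-far {I} {J} 3≤I+J 3+I+J≤N =
    trans (lap'-reflected N (ℕ.≤-trans (ℕ.m≤n+m _ 2) 3+I+J≤N))
          (lap₀-far 3≤I+J (subst (_≤ N) (ℕ.+-comm 3 (I + suc J)) 3+I+J≤N))

  L-reflected-wrap₁ : ∀ {I J} → suc (I + suc J) ≡ N → lap' N I (N ∸ suc J) ≡ ℚ.- 1ℚ
  L-reflected-wrap₁ 1+I+J≡N =
    trans (lap'-reflected N (ℕ.≤-reflexive 1+I+J≡N)) (lap₀-wrap₁ 5≤N 1+I+J≡N)

  L-reflected-wrap₂ : ∀ {I J} → 2 + (I + suc J) ≡ N → lap' N I (N ∸ suc J) ≡ ℚ.- 1ℚ
  L-reflected-wrap₂ 2+I+J≡N =
    trans (lap'-reflected N (ℕ.≤-trans (ℕ.n≤1+n _) (ℕ.≤-reflexive 2+I+J≡N))) (lap₀-wrap₂ 5≤N 2+I+J≡N)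

  twice : ∀ {x} → x ≡ m → x + x ≡ m + m
  twice x≡m = cong₂ _+_ x≡m x≡m

  2[2+a]≡4+2a : ∀ a → suc (suc a) + suc (suc a) ≡ 4 + 2 * a
  2[2+a]≡4+2a = solve-∀

  far-bound : ∀ {k a} → suc (3 + k + a) ≤ m → 6 + k ≤ N
  far-bound {k} {a} h = begin
    6 + k        ≡⟨ ℕ.+-comm 2 (4 + k) ⟩
    4 + k + 2    ≤⟨ ℕ.+-mono-≤ (ℕ.≤-trans (s≤s (s≤s (s≤s (s≤s (ℕ.m≤m+n k a))))) h) 2≤m ⟩
    m + m        ≤⟨ m+m≤N parity ⟩
    N            ∎
    where open ℕ.≤-Reasoning

  1+[3+k+a]≡3+k+[1+a] : ∀ k a → suc (3 + k + a) ≡ 3 + k + suc a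
  1+[3+k+a]≡3+k+[1+a] k a = cong (3 +_) (sym (ℕ.+-suc k a))

  L-above₃₊ : ∀ {k a} → suc (3 + k + a) ≤ m → lap' N (suc a) (suc (3 + k + a)) ≡ 0ℚ
  L-above₃₊ {k} {a} J≤m = begin
    lap' N (suc a) (suc (3 + k + a))   ≡⟨ cong (lap' N (suc a)) (1+[3+k+a]≡3+k+[1+a] k a) ⟩
    lap' N (suc a) (3 + k + suc a)     ≡⟨ lap'-above N (2 + k) (suc a) (<N J≤m′) ⟩
    lap₀ N (N ∸ (3 + k))               ≡⟨ lap₀-far (ℕ.m+n≤o⇒m≤o∸n 3 6+k≤N) N∸[3+k]+3≤N ⟩
    0ℚ                                 ∎
    where
    open ≡-Reasoning
    J≤m′ = subst (_≤ m) (1+[3+k+a]≡3+k+[1+a] k a) J≤m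
    6+k≤N = far-bound J≤m
    N∸[3+k]+3≤N : N ∸ (3 + k) + 3 ≤ N
    N∸[3+k]+3≤N = ℕ.≤-trans (ℕ.+-monoʳ-≤ (N ∸ (3 + k)) (ℕ.m≤m+n 3 k))
                            (ℕ.≤-reflexive (ℕ.m∸n+n≡m (ℕ.≤-trans (ℕ.m≤n+m (3 + k) 3) 6+k≤N)))

  L-below₃₊ : ∀ {k b} → suc (3 + k + b) ≤ m → lap' N (suc (3 + k + b)) (suc b) ≡ 0ℚ
  L-below₃₊ {k} {b} I≤m = begin
    lap' N (suc (3 + k + b)) (suc b)   ≡⟨ cong (λ x → lap' N x (suc b)) (1+[3+k+a]≡3+k+[1+a] k b) ⟩
    lap' N (3 + k + suc b) (suc b)     ≡⟨ lap'-below N (3 + k) (suc b) (<N I≤m′) ⟩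
    lap₀ N (3 + k)                     ≡⟨ lap₀-far (s≤s (s≤s (s≤s z≤n))) 3+k+3≤N ⟩
    0ℚ                                 ∎
    where
    open ≡-Reasoning
    I≤m′ = subst (_≤ m) (1+[3+k+a]≡3+k+[1+a] k b) I≤m
    3+k+3≤N = subst (_≤ N) (ℕ.+-comm 3 (3 + k)) (far-bound I≤m)

  2+a≤3+k+a : ∀ k a → suc (suc a) ≤ 3 + k + a
  2+a≤3+k+a k a = s≤s (s≤s (ℕ.≤-trans (ℕ.m≤n+m a k) (ℕ.n≤1+n _)))

  3+a≤3+k+a : ∀ k a → suc (suc (suc a)) ≤ 3 + k + a
  3+a≤3+k+a k a = s≤s (s≤s (s≤s (ℕ.m≤n+m a k)))

  3≤[2+a]+[1+b] : ∀ a b → 3 ≤ suc (suc a) + suc b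
  3≤[2+a]+[1+b] a b = s≤s (s≤s (ℕ.≤-trans (s≤s z≤n) (ℕ.m≤n+m (suc b) a)))

  3≤[1+a]+[2+b] : ∀ a b → 3 ≤ suc a + suc (suc b)
  3≤[1+a]+[2+b] a b = s≤s (ℕ.≤-trans (s≤s (s≤s z≤n)) (ℕ.m≤n+m (suc (suc b)) a))

  reflected-bound : ∀ p q {I J} → 3 ≤ p + q → p + I ≤ m → q + J ≤ m → 3 + (I + J) ≤ N
  reflected-bound p q {I} {J} 3≤p+q p+I≤m q+J≤m = begin
    3 + (I + J)          ≤⟨ ℕ.+-monoˡ-≤ (I + J) 3≤p+q ⟩
    p + q + (I + J)      ≡⟨ rearrange p q I J ⟩
    (p + I) + (q + J)    ≤⟨ ℕ.+-mono-≤ p+I≤m q+J≤m ⟩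
    m + m                ≤⟨ m+m≤N parity ⟩
    N                    ∎
    where
    open ℕ.≤-Reasoning
    rearrange : ∀ p q I J → p + q + (I + J) ≡ (p + I) + (q + J)
    rearrange = solve-∀

  lastDiagonal : Bool → ℚ
  lastDiagonal true  = nℚ 3
  lastDiagonal false = nℚ 2

  M-last : ∀ {o x} → Parity o → suc (suc x) ≡ m → M (suc x) (suc x) ≡ lastDiagonal o
  M-last {x = x} (odd N≡1+2m) 2+x≡m =
    WDWᵗ-last-odd N 2+x≡m (trans N≡1+2m (cong suc (trans (sym (twice 2+x≡m)) (2[2+a]≡4+2a x))))
  M-last {x = x} (even N≡2m) 2+x≡m =
    WDWᵗ-last-even N 2+x≡m (trans N≡2m (trans (sym (twice 2+x≡m)) (2[2+a]≡4+2a x)))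

  -- When m = 2 the index 1 is the last one, and then 5 ≤ N forces N = 5.
  M₁₁≡3 : ∀ {o} → Parity o → M 1 1 ≡ nℚ 3
  M₁₁≡3 π = [ WDWᵗ-interior N , last π ]′ (ℕ.m≤n⇒m<n∨m≡n 2≤m)
    where
    last : ∀ {o} → Parity o → 2 ≡ m → M 1 1 ≡ nℚ 3
    last (odd N≡1+2m) 2≡m = M-last (odd N≡1+2m) 2≡m
    last (even N≡2m)  2≡m = ⊥-elim (ℕ.<-irrefl refl (subst (5 ≤_) (trans N≡2m (sym (twice 2≡m))) 5≤N))

  diagonal-first : ∀ {o} → Goal o 0 0
  diagonal-first {o} = window-inner {o} 2≤m 2≤m
    (WDWᵗ-first N 2≤m) (WDWᵗ-sub N 2≤m) (WDWᵗ-super N 2≤m) (M₁₁≡3 parity)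
    (L-diagonal (ℕ.<⇒≤ 2≤m)) (trans (lap'-reflected N (<N 2≤m)) (lap₀-2 5≤N)) refl

  diagonal-last : ∀ {o a} → Parity o → suc (suc a) ≡ m → Goal o (suc a) (suc a)
  diagonal-last {a = a} (odd N≡1+2m) 2+a≡m = window {true} (isLast 2+a≡m) (isLast 2+a≡m)
    (M-last (odd N≡1+2m) 2+a≡m)
    refl refl refl
    (L-diagonal (ℕ.≤-reflexive 2+a≡m)) (L-reflected-wrap₁ (trans (cong suc (twice 2+a≡m)) (sym N≡1+2m))) refl
    refl
  diagonal-last {a = a} (even N≡2m) 2+a≡m = window {false} (isLast 2+a≡m) (isLast 2+a≡m)
    (M-last (even N≡2m) 2+a≡m)
    refl refl refl
    refl refl (trans (cong (lap' N (suc (suc a))) (sym 2+a≡m)) (L-diagonal (ℕ.≤-reflexive 2+a≡m)))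
    refl

  diagonal-penultimate : ∀ {o a} → Parity o → suc (suc (suc a)) ≡ m → Goal o (suc a) (suc a)
  diagonal-penultimate {a = a} (odd N≡1+2m) 3+a≡m = window {true} (isNotLast 2+a<m) (isNotLast 2+a<m)
    (WDWᵗ-interior N 2+a<m) (WDWᵗ-sub N 2+a<m) (WDWᵗ-super N 2+a<m)
    (M-last (odd N≡1+2m) 3+a≡m)
    (L-diagonal (ℕ.<⇒≤ 2+a<m))
    (L-reflected-far (3≤[2+a]+[1+b] a (suc a))
       (ℕ.≤-reflexive (trans (7+2a a) (trans (cong suc (twice 3+a≡m)) (sym N≡1+2m))))) refl
    refl
    where
    2+a<m : suc (suc a) < m
    2+a<m = ℕ.≤-reflexive 3+a≡m
    7+2a : ∀ a → 3 + (suc (suc a) + suc (suc a)) ≡ suc (suc (suc (suc a)) + suc (suc (suc a)))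
    7+2a = solve-∀
  diagonal-penultimate {a = a} (even N≡2m) 3+a≡m = window {false} (isNotLast 2+a<m) (isNotLast 2+a<m)
    (WDWᵗ-interior N 2+a<m) (WDWᵗ-sub N 2+a<m) (WDWᵗ-super N 2+a<m)
    (M-last (even N≡2m) 3+a≡m)
    (L-diagonal (ℕ.<⇒≤ 2+a<m))
    (L-reflected-wrap₂ (trans (6+2a a) (trans (twice 3+a≡m) (sym N≡2m)))) refl
    refl
    where
    2+a<m : suc (suc a) < m
    2+a<m = ℕ.≤-reflexive 3+a≡m
    6+2a : ∀ a → 2 + (suc (suc a) + suc (suc a)) ≡ suc (suc (suc a)) + suc (suc (suc a))
    6+2a = solve-∀

  diagonal-interior : ∀ {o a} → suc (suc (suc a)) < m → Goal o (suc a) (suc a)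
  diagonal-interior {o} {a} 3+a<m = window-inner {o} 2+a<m 2+a<m
    (WDWᵗ-interior N 2+a<m) (WDWᵗ-sub N 2+a<m) (WDWᵗ-super N 2+a<m) (WDWᵗ-interior N 3+a<m)
    (L-diagonal (ℕ.<⇒≤ 2+a<m))
    (L-reflected-far (3≤[2+a]+[1+b] a (suc a)) (reflected-bound 2 2 (s≤s (s≤s (s≤s z≤n))) 3+a<m 3+a<m))
    refl
    where
    2+a<m : suc (suc a) < m
    2+a<m = ℕ.<-trans (ℕ.n<1+n _) 3+a<m

  above₁-last : ∀ {o a} → Parity o → suc (suc a) ≡ m → Goal o a (suc a)
  above₁-last {a = a} (odd N≡1+2m) 2+a≡m = window {true} (isNotLast 1+a<m) (isLast 2+a≡m)
    (WDWᵗ-super N 1+a<m) (M-last (odd N≡1+2m) 2+a≡m)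
    refl refl
    (L-above₁ 1+a<m) (L-reflected-wrap₂ (trans (cong suc (twice 2+a≡m)) (sym N≡1+2m))) refl
    refl
    where
    1+a<m : suc a < m
    1+a<m = ℕ.≤-reflexive 2+a≡m
  above₁-last {a = a} (even N≡2m) 2+a≡m = window {false} (isNotLast 1+a<m) (isLast 2+a≡m)
    (WDWᵗ-super N 1+a<m) (M-last (even N≡2m) 2+a≡m)
    refl refl
    refl refl (trans (cong (lap' N (suc a)) (sym 2+a≡m)) (L-above₁ 1+a<m))
    refl
    where
    1+a<m : suc a < m
    1+a<m = ℕ.≤-reflexive 2+a≡m

  above₁-inner : ∀ {o a} → suc (suc a) < m → Goal o a (suc a)
  above₁-inner {o} {a} 2+a<m = window-inner {o} 1+a<m 2+a<m
    (WDWᵗ-super N 1+a<m) (WDWᵗ-interior N 2+a<m) (WDWᵗ-far N ℕ.≤-refl) (WDWᵗ-super N 2+a<m)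
    (L-above₁ 1+a<m) (L-reflected-far (3≤[1+a]+[2+b] a a) (reflected-bound 2 1 ℕ.≤-refl 2+a<m 2+a<m))
    refl
    where
    1+a<m : suc a < m
    1+a<m = ℕ.<-trans (ℕ.n<1+n _) 2+a<m

  above₂-last : ∀ {o a} → Parity o → suc (suc (suc a)) ≡ m → Goal o a (suc (suc a))
  above₂-last {a = a} (odd N≡1+2m) 3+a≡m = window {true} (isNotLast 1+a<m) (isLast 3+a≡m)
    (WDWᵗ-far N ℕ.≤-refl) (WDWᵗ-super N (ℕ.≤-reflexive 3+a≡m)) refl refl
    (L-above₂ (ℕ.≤-reflexive 3+a≡m))
    (L-reflected-far (3≤[1+a]+[2+b] a (suc a)) (ℕ.≤-reflexive (trans (cong suc (twice 3+a≡m)) (sym N≡1+2m)))) refl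
    refl
    where
    1+a<m : suc a < m
    1+a<m = ℕ.≤-trans (ℕ.n≤1+n _) (ℕ.≤-reflexive 3+a≡m)
  above₂-last {a = a} (even N≡2m) 3+a≡m = window {false} (isNotLast 1+a<m) (isLast 3+a≡m)
    (WDWᵗ-far N ℕ.≤-refl) (WDWᵗ-super N (ℕ.≤-reflexive 3+a≡m)) refl refl
    refl refl (trans (cong (lap' N (suc a)) (sym 3+a≡m)) (L-above₂ (ℕ.≤-reflexive 3+a≡m)))
    refl
    where
    1+a<m : suc a < m
    1+a<m = ℕ.≤-trans (ℕ.n≤1+n _) (ℕ.≤-reflexive 3+a≡m)

  above₂-inner : ∀ {o a} → suc (suc (suc a)) < m → Goal o a (suc (suc a))
  above₂-inner {o} {a} 3+a<m = window-inner {o} 1+a<m 3+a<m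
    (WDWᵗ-far N ℕ.≤-refl) (WDWᵗ-super N 2+a<m) (WDWᵗ-far N (ℕ.n≤1+n _)) (WDWᵗ-far N ℕ.≤-refl)
    (L-above₂ 2+a<m) (L-reflected-far (3≤[1+a]+[2+b] a (suc a)) (reflected-bound 3 1 (ℕ.n≤1+n 3) 3+a<m 3+a<m))
    refl
    where
    2+a<m : suc (suc a) < m
    2+a<m = ℕ.<-trans (ℕ.n<1+n _) 3+a<m
    1+a<m : suc a < m
    1+a<m = ℕ.<-trans (ℕ.n<1+n _) 2+a<m

  above₃₊-last : ∀ {o a k} → Parity o → suc (3 + k + a) ≡ m → Goal o a (3 + k + a)
  above₃₊-last {a = a} {k} (odd N≡1+2m) J≡m = window {true} (isNotLast 1+a<m) (isLast J≡m)
    (WDWᵗ-far N (2+a≤3+k+a k a)) (WDWᵗ-far N (3+a≤3+k+a k a)) refl refl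
    (L-above₃₊ {k} {a} (ℕ.≤-reflexive J≡m))
    (L-reflected-far (3≤[1+a]+[2+b] a _) (reflected-bound 3 0 ℕ.≤-refl 4+a≤m (ℕ.≤-reflexive J≡m)))
    refl refl
    where
    4+a≤m : 4 + a ≤ m
    4+a≤m = ℕ.≤-trans (s≤s (3+a≤3+k+a k a)) (ℕ.≤-reflexive J≡m)
    1+a<m : suc a < m
    1+a<m = ℕ.≤-trans (ℕ.m≤n+m _ 2) 4+a≤m
  above₃₊-last {a = a} {k} (even N≡2m) J≡m = window {false} (isNotLast 1+a<m) (isLast J≡m)
    (WDWᵗ-far N (2+a≤3+k+a k a)) (WDWᵗ-far N (3+a≤3+k+a k a)) refl refl
    refl refl (trans (cong (lap' N (suc a)) (sym J≡m)) (L-above₃₊ {k} {a} (ℕ.≤-reflexive J≡m)))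
    refl
    where
    1+a<m : suc a < m
    1+a<m = ℕ.≤-trans (ℕ.m≤n+m _ 2) (ℕ.≤-trans (s≤s (3+a≤3+k+a k a)) (ℕ.≤-reflexive J≡m))

  above₃₊-inner : ∀ {o a k} → suc (3 + k + a) < m → Goal o a (3 + k + a)
  above₃₊-inner {o} {a} {k} J<m = window-inner {o} 1+a<m J<m
    (WDWᵗ-far N (2+a≤3+k+a k a)) (WDWᵗ-far N (3+a≤3+k+a k a))
    (WDWᵗ-far N (ℕ.≤-trans (2+a≤3+k+a k a) (ℕ.n≤1+n _)))
    (WDWᵗ-far N (ℕ.≤-trans (3+a≤3+k+a k a) (ℕ.n≤1+n _)))
    (L-above₃₊ {k} {a} (ℕ.<⇒≤ J<m))
    (L-reflected-far (3≤[1+a]+[2+b] a _) (reflected-bound 3 1 (ℕ.n≤1+n 3) 4+a≤m J<m))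
    refl
    where
    4+a≤m : 4 + a ≤ m
    4+a≤m = ℕ.≤-trans (s≤s (3+a≤3+k+a k a)) (ℕ.<⇒≤ J<m)
    1+a<m : suc a < m
    1+a<m = ℕ.≤-trans (ℕ.m≤n+m _ 2) 4+a≤m

  below₁-last : ∀ {o b} → Parity o → suc (suc b) ≡ m → Goal o (suc b) b
  below₁-last {b = b} (odd N≡1+2m) 2+b≡m = window {true} (isLast 2+b≡m) (isNotLast 1+b<m)
    (WDWᵗ-sub N 1+b<m) refl
    (M-last (odd N≡1+2m) 2+b≡m) refl
    (L-below₁ 1+b<m) (L-reflected-wrap₂ (trans (5+2b b) (trans (cong suc (twice 2+b≡m)) (sym N≡1+2m)))) refl
    refl
    where
    1+b<m : suc b < m
    1+b<m = ℕ.≤-reflexive 2+b≡m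
    5+2b : ∀ b → 2 + (suc (suc b) + suc b) ≡ suc (suc (suc b) + suc (suc b))
    5+2b = solve-∀
  below₁-last {b = b} (even N≡2m) 2+b≡m = window {false} (isLast 2+b≡m) (isNotLast 1+b<m)
    (WDWᵗ-sub N 1+b<m) refl
    (M-last (even N≡2m) 2+b≡m) refl
    (L-below₁ 1+b<m) (L-reflected-wrap₁ (trans (4+2b b) (trans (twice 2+b≡m) (sym N≡2m)))) refl
    refl
    where
    1+b<m : suc b < m
    1+b<m = ℕ.≤-reflexive 2+b≡m
    4+2b : ∀ b → suc (suc (suc b) + suc b) ≡ suc (suc b) + suc (suc b)
    4+2b = solve-∀

  below₁-inner : ∀ {o b} → suc (suc b) < m → Goal o (suc b) b
  below₁-inner {o} {b} 2+b<m = window-inner {o} 2+b<m 1+b<m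
    (WDWᵗ-sub N 1+b<m) (WDWᵗ-below N ℕ.≤-refl) (WDWᵗ-interior N 2+b<m) (WDWᵗ-sub N 2+b<m)
    (L-below₁ 1+b<m) (L-reflected-far (3≤[2+a]+[1+b] b b) (reflected-bound 1 2 ℕ.≤-refl 2+b<m 2+b<m))
    refl
    where
    1+b<m : suc b < m
    1+b<m = ℕ.<-trans (ℕ.n<1+n _) 2+b<m

  below₂-last : ∀ {o b} → Parity o → suc (suc (suc b)) ≡ m → Goal o (suc (suc b)) b
  below₂-last {b = b} (odd N≡1+2m) 3+b≡m = window {true} (isLast 3+b≡m) (isNotLast 1+b<m)
    (WDWᵗ-below N ℕ.≤-refl) refl (WDWᵗ-sub N (ℕ.≤-reflexive 3+b≡m)) refl
    (L-below₂ (ℕ.≤-reflexive 3+b≡m))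
    (L-reflected-far (3≤[2+a]+[1+b] (suc b) b)
       (ℕ.≤-reflexive (trans (7+2b b) (trans (cong suc (twice 3+b≡m)) (sym N≡1+2m)))))
    refl refl
    where
    1+b<m : suc b < m
    1+b<m = ℕ.≤-trans (ℕ.n≤1+n _) (ℕ.≤-reflexive 3+b≡m)
    7+2b : ∀ b → 3 + (suc (suc (suc b)) + suc b) ≡ suc (suc (suc (suc b)) + suc (suc (suc b)))
    7+2b = solve-∀
  below₂-last {b = b} (even N≡2m) 3+b≡m = window {false} (isLast 3+b≡m) (isNotLast 1+b<m)
    (WDWᵗ-below N ℕ.≤-refl) refl (WDWᵗ-sub N (ℕ.≤-reflexive 3+b≡m)) refl
    (L-below₂ (ℕ.≤-reflexive 3+b≡m))
    (L-reflected-wrap₂ (trans (6+2b b) (trans (twice 3+b≡m) (sym N≡2m))))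
    refl refl
    where
    1+b<m : suc b < m
    1+b<m = ℕ.≤-trans (ℕ.n≤1+n _) (ℕ.≤-reflexive 3+b≡m)
    6+2b : ∀ b → 2 + (suc (suc (suc b)) + suc b) ≡ suc (suc (suc b)) + suc (suc (suc b))
    6+2b = solve-∀

  below₂-inner : ∀ {o b} → suc (suc (suc b)) < m → Goal o (suc (suc b)) b
  below₂-inner {o} {b} 3+b<m = window-inner {o} 3+b<m 1+b<m
    (WDWᵗ-below N ℕ.≤-refl) (WDWᵗ-below N (ℕ.n≤1+n _)) (WDWᵗ-sub N 2+b<m) (WDWᵗ-below N ℕ.≤-refl)
    (L-below₂ 2+b<m) (L-reflected-far (3≤[2+a]+[1+b] (suc b) b) (reflected-bound 1 3 (ℕ.n≤1+n 3) 3+b<m 3+b<m))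
    refl
    where
    2+b<m : suc (suc b) < m
    2+b<m = ℕ.<-trans (ℕ.n<1+n _) 3+b<m
    1+b<m : suc b < m
    1+b<m = ℕ.<-trans (ℕ.n<1+n _) 2+b<m

  below₃₊-last : ∀ {o b k} → Parity o → suc (3 + k + b) ≡ m → Goal o (3 + k + b) b
  below₃₊-last {o} {b} {k} π I≡m = window {o} (isLast I≡m) (isNotLast 1+b<m)
    (WDWᵗ-below N (2+a≤3+k+a k b)) refl (WDWᵗ-below N (3+a≤3+k+a k b)) refl
    (L-below₃₊ {k} {b} (ℕ.≤-reflexive I≡m))
    (L-reflected-far (3≤[2+a]+[1+b] (suc (suc (k + b))) b)
       (reflected-bound 0 3 ℕ.≤-refl (ℕ.≤-reflexive I≡m) 4+b≤m))
    refl (values π)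
    where
    4+b≤m : 4 + b ≤ m
    4+b≤m = ℕ.≤-trans (s≤s (3+a≤3+k+a k b)) (ℕ.≤-reflexive I≡m)
    1+b<m : suc b < m
    1+b<m = ℕ.≤-trans (ℕ.m≤n+m _ 2) 4+b≤m
    values : ∀ {o} → Parity o → Δ² true false 0ℚ (M (suc (3 + k + b)) b) 0ℚ (M (suc (3 + k + b)) (suc b))
                              ≡ foldedEntry o false true 0ℚ 0ℚ (lap' N (suc (3 + k + b)) m)
    values (odd _)  = refl
    values (even _) = refl

  below₃₊-inner : ∀ {o b k} → suc (3 + k + b) < m → Goal o (3 + k + b) b
  below₃₊-inner {o} {b} {k} I<m = window-inner {o} I<m 1+b<m
    (WDWᵗ-below N (2+a≤3+k+a k b)) (WDWᵗ-below N (ℕ.≤-trans (2+a≤3+k+a k b) (ℕ.n≤1+n _)))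
    (WDWᵗ-below N (3+a≤3+k+a k b)) (WDWᵗ-below N (ℕ.≤-trans (3+a≤3+k+a k b) (ℕ.n≤1+n _)))
    (L-below₃₊ {k} {b} (ℕ.<⇒≤ I<m))
    (L-reflected-far (3≤[2+a]+[1+b] (suc (suc (k + b))) b)
       (reflected-bound 1 3 (ℕ.n≤1+n 3) I<m 4+b≤m))
    refl
    where
    4+b≤m : 4 + b ≤ m
    4+b≤m = ℕ.≤-trans (s≤s (3+a≤3+k+a k b)) (ℕ.<⇒≤ I<m)
    1+b<m : suc b < m
    1+b<m = ℕ.≤-trans (ℕ.m≤n+m _ 2) 4+b≤m

  data Offset : ℕ → ℕ → Set where
    diagonal : ∀ a → Offset a a
    above₁   : ∀ a → Offset a (suc a)
    above₂   : ∀ a → Offset a (suc (suc a))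
    above₃₊  : ∀ a k → Offset a (3 + k + a)
    below₁   : ∀ b → Offset (suc b) b
    below₂   : ∀ b → Offset (suc (suc b)) b
    below₃₊  : ∀ b k → Offset (3 + k + b) b

  offset : ∀ a b → Offset a b
  offset a b with ℕ.<-cmp a b
  ... | tri≈ _ refl _ = diagonal a
  ... | tri< a<b _ _  = above (b ∸ a) (ℕ.m∸n+n≡m (ℕ.<⇒≤ a<b)) (ℕ.m<n⇒0<n∸m a<b)
    where
    above : ∀ d → d + a ≡ b → 0 < d → Offset a b
    above 1                   refl _ = above₁ a
    above 2                   refl _ = above₂ a
    above (suc (suc (suc k))) refl _ = above₃₊ a k
  ... | tri> _ _ b<a  = below (a ∸ b) (ℕ.m∸n+n≡m (ℕ.<⇒≤ b<a)) (ℕ.m<n⇒0<n∸m b<a)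
    where
    below : ∀ d → d + b ≡ a → 0 < d → Offset a b
    below 1                   refl _ = below₁ b
    below 2                   refl _ = below₂ b
    below (suc (suc (suc k))) refl _ = below₃₊ b k

  by-position : ∀ {x} {P : Set} → x < m → (suc x ≡ m → P) → (suc x < m → P) → P
  by-position x<m last inner = [ inner , last ]′ (ℕ.m≤n⇒m<n∨m≡n x<m)

  goal : ∀ {o} → Parity o → ∀ {a b} → a < m → b < m → Goal o a b
  goal {o} π a<m b<m = by-offset (offset _ _) a<m b<m
    where
    by-offset : ∀ {a b} → Offset a b → a < m → b < m → Goal o a b
    by-offset (diagonal zero)    _   _   = diagonal-first {o}
    by-offset (diagonal (suc a)) a<m _   = by-position a<m (diagonal-last π) λ 2+a<m →
                                             by-position 2+a<m (diagonal-penultimate π) (diagonal-interior {o})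
    by-offset (above₁ a)         _   b<m = by-position b<m (above₁-last π) (above₁-inner {o})
    by-offset (above₂ a)         _   b<m = by-position b<m (above₂-last π) (above₂-inner {o})
    by-offset (above₃₊ a k)      _   b<m = by-position b<m (above₃₊-last π) (above₃₊-inner {o})
    by-offset (below₁ b)         a<m _   = by-position a<m (below₁-last π) (below₁-inner {o})
    by-offset (below₂ b)         a<m _   = by-position a<m (below₂-last π) (below₂-inner {o})
    by-offset (below₃₊ b k)      a<m _   = by-position a<m (below₃₊-last π) (below₃₊-inner {o})

theorem3p1 : (N : ℕ) → .{{_ : NonZero N}} → 5 ≤ N →
    Σ (Mat (N / 2)) (λ Uinv → IsInverse (U N) Uinv)
    × ((Uinv : Mat (N / 2)) → IsInverse (U N) Uinv →
        (i j : Fin (N / 2)) →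
        H N i j ≡ (Uinv ⊗ W N ⊗ D N ⊗ transpose (W N) ⊗ transpose Uinv) i j)
theorem3p1 N 5≤N = (V , U⊗V , V⊗U) , λ Uinv (_ , Uinv⊗U) i j →
  let Uinv≋V = inverse-unique {A = U N} {C = Uinv} U⊗V Uinv⊗U in sym (begin
  (Uinv ⊗ W N ⊗ D N ⊗ transpose (W N) ⊗ transpose Uinv) i j
    ≡⟨ trans (⊗-congˡ (transpose Uinv) (⊗-congˡ (transpose (W N)) (⊗-congˡ (D N) (⊗-congˡ (W N) Uinv≋V))) i j)
             (⊗-congʳ (V ⊗ W N ⊗ D N ⊗ transpose (W N)) (λ k l → Uinv≋V l k) i j) ⟩
  (V ⊗ W N ⊗ D N ⊗ transpose (W N) ⊗ transpose V) i j
    ≡⟨ ⊗-congˡ (transpose V) (λ k l → trans (⊗-congˡ (transpose (W N)) (⊗-assoc V (W N) (D N)) k l)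
                                             (⊗-assoc V (W N ⊗ D N) (transpose (W N)) k l)) i j ⟩
  (V ⊗ (W N ⊗ D N ⊗ transpose (W N)) ⊗ transpose V) i j
    ≡⟨ V-conjugate (WDWᵗ N) (Fin.toℕ<n i) (Fin.toℕ<n j) ⟩
  ΔM (toℕ i) (toℕ j)
    ≡⟨ goal parity (Fin.toℕ<n i) (Fin.toℕ<n j) ⟩
  H N i j ∎)
  where
  open ≡-Reasoning
  open Folded N 5≤N
  V : Mat m
  V = ⟦ Vℕ ⟧
  U⊗V : U N ⊗ V ≋ idMat
  U⊗V i j = U⊗V≡id (toℕ i) (Fin.toℕ<n j)
  V⊗U : V ⊗ U N ≋ idMat
  V⊗U i j = V⊗U≡id (Fin.toℕ<n i) (Fin.toℕ<n j)
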